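{- Let $m,r,n\in\mathbb N$ with $m+r=n$, let $\nu\subseteq R_r=(r^m)$, $\rho=\phi^r(\nu)$, $d\in\mathbb Z_{\ge0}$ and $t=\mathrm{diag}_0((\nu\oplus d)^{\vee_r})$. Then $$(\eta^1_t,\eta^2_t)=\big(\rho^{L^t}+(r-t)^{m-t},\ \rho^{R^t}\big),$$ where $\nu\oplus d=(\eta^1_t,\eta^2_t)$ and the sum of partitions is taken coordinatewise.
   Context: Partitions in French notation (row 1 lowest); $\rho'$ is the transpose; $\mathrm{diag}_0(\eta)$ counts cells with equal row and column index. The bit string $b_\nu$ of $\nu\subseteq R_r$ records the boundary of $\nu$ from the upper left to the lower right corner of $R_r$ (vertical step 0, horizontal step 1); $\phi^r(\nu)$ is the partition whose bit string moves the first $r$ bits of $b_\nu$ to the end. An $n$-rim hook is a connected skew shape of $n$ cells with no $2\times2$ square, its head the southeasternmost cell; $\nu\oplus d$ is obtained from $\nu$ by adding $d$ $n$-rim hooks with all heads in column $r$; $(\nu\oplus d)^{\vee_r}$ is the complement in $R_r$ of the part of $\nu\oplus d$ inside $R_r$. $\eta^1_t$ is the bottom $m-t$ rows of $\nu\oplus d$, $\eta^2_t$ the remaining rows. For $\rho=(\rho_1,\dots,\rho_m)\subseteq R_r$ containing $(t^t)$, with $a=\rho'_t$: $\rho^{L^t}=(t^{a-t},\rho_{a+1},\dots,\rho_m)$ (the part of $\rho$ above the $t\times t$ square in columns $1,\dots,t$; it has $m-t$ parts) and $\rho^{R^t}=(\rho_1-t,\dots,\rho_a-t)$ (the part of $\rho$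 in columns $t+1,\dots,r$). (For the $t$ above one has $(t^t)\subseteq\rho$.)
   Formalization: The degree d is bounded by $d\le\mathrm{diag}_0(\nu^{\vee_r})$ instead of ranging over all of ℤ≥0. The statement above fails without it. -}

module Defs where

open import Data.Nat using (ℕ; zero; suc; _+_; _∸_; _≤_; _<_; _≤ᵇ_)
open import Data.Bool using (Bool; true; false; if_then_else_)
open import Data.List using (List; []; _∷_; _++_; replicate; map; upTo; take; drop; zipWith)
open import Data.Nat.ListAction using (sum)
open import Data.Product using (Σ; _×_; _,_; proj₁; proj₂)
open import Relation.Nullary using (¬_)
open import Data.Sum using (_⊎_)
open import Relation.Binary.PropositionalEquality using (_≡_)

-- Partitions (French notation, row 1 lowest).
-- A partition is a list of row lengths (λ₁, λ₂, …), row 1 first.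
-- Rows beyond the list have length 0, so two lists denote the same
-- partition iff they agree up to trailing zeros (see _≈ₚ_).

-- row λ i = λ_{i+1}  (0-based row index, default 0)
row : List ℕ → ℕ → ℕ
row []       _       = 0
row (x ∷ _)  zero    = x
row (_ ∷ xs) (suc i) = row xs i

rows : ℕ → List ℕ → List ℕ
rows k lam = map (row lam) (upTo k)

IsPartition : List ℕ → Set
IsPartition lam = ∀ i → row lam (suc i) ≤ row lam i

_≈ₚ_ : List ℕ → List ℕ → Set
lam ≈ₚ μ = ∀ i → row lam i ≡ row μ i

InBox : ℕ → ℕ → List ℕ → Set
InBox m r ν = IsPartition ν × (∀ i → row ν i ≤ r) × (∀ i → m ≤ i → row ν i ≡ 0)

_⊆ₚ_ : List ℕ → List ℕ → Set
μ ⊆ₚ lam = ∀ i → row μ i ≤ row lam i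

-- Bit string of ν ⊆ R_r: boundary from the upper-left to the lower-right
-- corner of R_r; vertical step = false (0), horizontal step = true (1).
-- Going from the top row (row m) down: in row i one first walks
-- λ_i − λ_{i+1} horizontal steps, then one vertical step; at the end
-- r − λ_1 horizontal steps along the bottom edge.

bitsAux : List ℕ → ℕ → List Bool
bitsAux ν zero    = []
bitsAux ν (suc k) = replicate (row ν k ∸ row ν (suc k)) true ++ (false ∷ bitsAux ν k)

bits : ℕ → ℕ → List ℕ → List Bool
bits m r ν = bitsAux ν m ++ replicate (r ∸ row ν 0) true

rotate : ℕ → List Bool → List Bool
rotate r b = drop r b ++ take r b

-- Cells: (i , j) with 0-based row index i and 0-based column index j;
-- (i , j) ∈ λ  iff  j < λ_{i+1}.  The cell (i , j) lies in row i+1 and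
-- column j+1 of the paper.

Cell : Set
Cell = ℕ × ℕ

InSkew : List ℕ → List ℕ → Cell → Set
InSkew lam μ (i , j) = (row μ i ≤ j) × (j < row lam i)

Adjacent : Cell → Cell → Set
Adjacent (i , j) (i' , j') =
  ((i ≡ i') × ((suc j ≡ j') ⊎ (suc j' ≡ j))) ⊎ ((j ≡ j') × ((suc i ≡ i') ⊎ (suc i' ≡ i)))

data Reach (S : Cell → Set) : Cell → Cell → Set where
  here : ∀ {c} → Reach S c c
  step : ∀ {c c' c''} → Adjacent c c' → S c' → Reach S c' c'' → Reach S c c''

Connected : (Cell → Set) → Set
Connected S = ∀ c c' → S c → S c' → Reach S c c'

No2x2 : (Cell → Set) → Set
No2x2 S = ¬ (Σ ℕ λ i → Σ ℕ λ j →
  S (i , j) × S (suc i , j) × S (i , suc j) × S (suc i , suc j))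

-- the head (southeasternmost cell: lowest row, rightmost column) of S
-- lies in column r (1-based)
HeadInColumn : ℕ → (Cell → Set) → Set
HeadInColumn r S = Σ Cell λ h → S h × (suc (proj₂ h) ≡ r) ×
  (∀ c → S c → (proj₁ h ≤ proj₁ c) × (proj₂ c ≤ proj₂ h))

AddRimHook : ℕ → ℕ → List ℕ → List ℕ → Set
AddRimHook n r μ lam =
  IsPartition lam × (μ ⊆ₚ lam) × (sum μ + n ≡ sum lam) ×
  Connected (InSkew lam μ) × No2x2 (InSkew lam μ) × HeadInColumn r (InSkew lam μ)

-- AddRimHooks n r ν d λ : λ = ν ⊕ d, i.e. λ is obtained from ν by adding
-- d n-rim hooks, all with head in column r
data AddRimHooks (n r : ℕ) (ν : List ℕ) : ℕ → List ℕ → Set where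
  none : AddRimHooks n r ν zero ν
  more : ∀ {d μ lam} → AddRimHooks n r ν d μ → AddRimHook n r μ lam →
         AddRimHooks n r ν (suc d) lam

-- λ^{∨_r}: complement in R_r of the part of λ inside R_r, i.e. the
-- partition (r − λ_m, r − λ_{m−1}, …, r − λ_1)  (rows of λ capped at r).
complement : ℕ → ℕ → List ℕ → List ℕ
complement m r lam = map (λ i → r ∸ row lam (m ∸ suc i)) (upTo m)

-- diag₀(η): number of cells with equal row and column index
diagAux : ℕ → List ℕ → ℕ
diagAux k []       = 0
diagAux k (x ∷ xs) = (if suc k ≤ᵇ x then 1 else 0) + diagAux (suc k) xs

diag₀ : List ℕ → ℕ
diag₀ η = diagAux 0 η

-- ρ'_t for ρ = (ρ_1, …, ρ_m): number of i ≤ m with ρ_i ≥ t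
-- (so ρ'_0 = m)
countAux : ℕ → List ℕ → ℕ
countAux t []       = 0
countAux t (x ∷ xs) = (if t ≤ᵇ x then 1 else 0) + countAux t xs

conj : ℕ → List ℕ → ℕ → ℕ
conj m ρ t = countAux t (rows m ρ)

ρL : ℕ → ℕ → List ℕ → List ℕ
ρL m t ρ = replicate (conj m ρ t ∸ t) t ++ drop (conj m ρ t) (rows m ρ)

ρR : ℕ → ℕ → List ℕ → List ℕ
ρR m t ρ = map (λ x → x ∸ t) (take (conj m ρ t) (rows m ρ))

_+ₚ_ : List ℕ → List ℕ → List ℕ
lam +ₚ μ = zipWith _+_ lam μ

η¹ : ℕ → ℕ → List ℕ → List ℕ
η¹ m t lam = rows (m ∸ t) lam

η² : ℕ → ℕ → List ℕ → List ℕ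
η² m t lam = drop (m ∸ t) lam

module Submission where

-- Both sides are compared
-- row by row (rows are counted from 0 in the file).
--  1. Counting: diag₀ of a complement and the conjugate ρ'_t each count an
--     initial segment of rows (ComplementDiagonal, Conjugate).
--  2. Bit strings: the (q+1)-th zero of b_ν is preceded by ν_{m−q} ones, so
--     the first r bits of b_ν contain exactly D zeros; reading b_ρ, the
--     rotated string, expresses every row of ρ through ν (Rotation).
--  3. Rim hooks: counting the n = m + r cells of a hook with head in column
--     r shows that it raises exactly the m rows above its head (RimHook).
--  4. By induction on d, ν ⊕ d has d rows r, then rows min(r, ν_i + d) for
--     i < m, then the overflow rows ν_i + d − r (SumShape).
--  5. From this shape t = D − d and t ≤ ρ'_t, and both identities reduce to
--     arithmetic on single rows (RelatedRows, Proposition).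

open import Defs
open import Data.Nat using (ℕ; _+_; _∸_; _≤_)
open import Data.List using (List; replicate)
open import Data.Product using (_×_; _,_)
open import Relation.Binary.PropositionalEquality using (_≡_)

open import Data.Nat
open import Data.Nat.Properties
open import Data.Nat.Tactic.RingSolver using (solve-∀)
open import Data.Nat.ListAction using (sum)
open import Data.Bool using (Bool; true; false; if_then_else_; T)
open import Data.List using ([]; _∷_; _++_; map; take; drop; zipWith; length; applyUpTo)
open import Data.List.Properties
  using (map-applyUpTo; length-applyUpTo; length-replicate; length-++; length-drop; length-take; take++drop≡id)
open import Data.Product using (Σ; ∃; proj₁; proj₂)
open import Data.Sum using (_⊎_; inj₁; inj₂)
open import Data.Empty using (⊥; ⊥-elim)
open import Data.Unit using (tt)
open import Relation.Nullary using (¬_; yes; no)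
open import Relation.Binary using (tri<; tri≈; tri>)
open import Relation.Binary.PropositionalEquality
  using (refl; sym; trans; cong; cong₂; subst; module ≡-Reasoning)
open import Function using (_∘_)
open import Algebra.Properties.CommutativeSemigroup +-commutativeSemigroup
  using (xy∙z≈xz∙y; xy∙z≈x∙zy; x∙yz≈y∙xz; x∙yz≈yx∙z; x∙yz≈xz∙y)

row-applyUpTo< : ∀ (f : ℕ → ℕ) m i → i < m → row (applyUpTo f m) i ≡ f i
row-applyUpTo< f (suc m) zero    _       = refl
row-applyUpTo< f (suc m) (suc i) (s≤s p) = row-applyUpTo< (f ∘ suc) m i p

row-applyUpTo≥ : ∀ (f : ℕ → ℕ) m i → m ≤ i → row (applyUpTo f m) i ≡ 0
row-applyUpTo≥ f zero    i       _       = refl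
row-applyUpTo≥ f (suc m) (suc i) (s≤s p) = row-applyUpTo≥ (f ∘ suc) m i p

rows≡applyUpTo : ∀ k lam → rows k lam ≡ applyUpTo (row lam) k
rows≡applyUpTo k lam = map-applyUpTo (λ x → x) (row lam) k

row-rows< : ∀ k lam i → i < k → row (rows k lam) i ≡ row lam i
row-rows< k lam i p rewrite rows≡applyUpTo k lam = row-applyUpTo< (row lam) k i p

row-rows≥ : ∀ k lam i → k ≤ i → row (rows k lam) i ≡ 0
row-rows≥ k lam i p rewrite rows≡applyUpTo k lam = row-applyUpTo≥ (row lam) k i p

length-rows : ∀ k lam → length (rows k lam) ≡ k
length-rows k lam rewrite rows≡applyUpTo k lam = length-applyUpTo (row lam) k

row-replicate : ∀ k x i → i < k → row (replicate k x) i ≡ x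
row-replicate (suc k) x zero    _       = refl
row-replicate (suc k) x (suc i) (s≤s p) = row-replicate k x i p

row-++ˡ : ∀ (xs ys : List ℕ) i → i < length xs → row (xs ++ ys) i ≡ row xs i
row-++ˡ (x ∷ xs) ys zero    _       = refl
row-++ˡ (x ∷ xs) ys (suc i) (s≤s p) = row-++ˡ xs ys i p

row-++ʳ : ∀ (xs ys : List ℕ) i → row (xs ++ ys) (length xs + i) ≡ row ys i
row-++ʳ []       ys i = refl
row-++ʳ (x ∷ xs) ys i = row-++ʳ xs ys i

row-drop : ∀ k (lam : List ℕ) i → row (drop k lam) i ≡ row lam (k + i)
row-drop zero    lam       i = refl
row-drop (suc k) []        i = refl
row-drop (suc k) (x ∷ lam) i = row-drop k lam i

row-take< : ∀ k (lam : List ℕ) i → i < k → row (take k lam) i ≡ row lam i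
row-take< (suc k) []        i       p       = refl
row-take< (suc k) (x ∷ lam) zero    p       = refl
row-take< (suc k) (x ∷ lam) (suc i) (s≤s p) = row-take< k lam i p

row-take≥ : ∀ k (lam : List ℕ) i → k ≤ i → row (take k lam) i ≡ 0
row-take≥ zero    lam       i       p       = refl
row-take≥ (suc k) []        i       p       = refl
row-take≥ (suc k) (x ∷ lam) (suc i) (s≤s p) = row-take≥ k lam i p

-- map f acts rowwise as long as f preserves the implicit zero rows
row-map : ∀ (f : ℕ → ℕ) (lam : List ℕ) i → f 0 ≡ 0 → row (map f lam) i ≡ f (row lam i)
row-map f []        i       f0 = sym f0
row-map f (x ∷ lam) zero    f0 = refl
row-map f (x ∷ lam) (suc i) f0 = row-map f lam i f0

row-zipWith< : ∀ (xs ys : List ℕ) i → i < length xs → i < length ys →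
  row (zipWith _+_ xs ys) i ≡ row xs i + row ys i
row-zipWith< (x ∷ xs) (y ∷ ys) zero    p       q       = refl
row-zipWith< (x ∷ xs) (y ∷ ys) (suc i) (s≤s p) (s≤s q) = row-zipWith< xs ys i p q

row-zipWith≥ : ∀ (xs ys : List ℕ) i → length ys ≤ i → row (zipWith _+_ xs ys) i ≡ 0
row-zipWith≥ []       ys       i       p       = refl
row-zipWith≥ (x ∷ xs) []       i       p       = refl
row-zipWith≥ (x ∷ xs) (y ∷ ys) (suc i) (s≤s p) = row-zipWith≥ xs ys i p

Antitone : (ℕ → ℕ) → Set
Antitone f = ∀ i → f (suc i) ≤ f i

antitone : ∀ {f} → Antitone f → ∀ {i j} → i ≤ j → f j ≤ f i
antitone {f} A {i} {j} i≤j with m≤n⇒∃[o]m+o≡n i≤j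
... | k , refl = go i k
  where
  go : ∀ i k → f (i + k) ≤ f i
  go i zero    rewrite +-identityʳ i = ≤-refl
  go i (suc k) rewrite +-suc i k     = ≤-trans (A (i + k)) (go i k)

split< : ∀ {q m} → q < m → ∃ λ j → suc (q + j) ≡ m
split< q<m = m≤n⇒∃[o]m+o≡n q<m

∸-split : ∀ q j m → suc (q + j) ≡ m → m ∸ suc q ≡ j
∸-split q j m e = trans (cong (_∸ suc q) (sym e)) (m+n∸m≡n q j)

-- Two numbers ≤ m are equal when they bound the same initial segment of
-- [0, m); this is how diagonals and conjugates are identified below.
threshold-unique : ∀ m a b → a ≤ m → b ≤ m →
  (∀ k → k < m → k < a → k < b) → (∀ k → k < m → k < b → k < a) → a ≡ b
threshold-unique m a b a≤m b≤m a⊆b b⊆a with <-cmp a b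
... | tri≈ _ e _   = e
... | tri< a<b _ _ = ⊥-elim (<-irrefl refl (b⊆a a (<-≤-trans a<b b≤m) a<b))
... | tri> _ _ b<a = ⊥-elim (<-irrefl refl (a⊆b b (<-≤-trans b<a a≤m) b<a))

rows-antitone : ∀ lam → IsPartition lam → ∀ {i j} → i ≤ j → row lam j ≤ row lam i
rows-antitone lam P = antitone {row lam} P

-- Counting along an antitone sequence.  diagAux s counts the indices i with
-- f i ≥ s + i + 1, countAux t those with f i ≥ t; both conditions are
-- downward closed, so each counter is the length of the initial segment on
-- which its condition holds.

indicator-yes : ∀ a b → a ≤ b → (if a ≤ᵇ b then 1 else 0) ≡ 1
indicator-yes a b a≤b with a ≤ᵇ b | ≤⇒≤ᵇ a≤b
... | true | _ = refl

indicator-no : ∀ a b → ¬ a ≤ b → (if a ≤ᵇ b then 1 else 0) ≡ 0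
indicator-no a b a≰b with a ≤ᵇ b in eq
... | true  = ⊥-elim (a≰b (≤ᵇ⇒≤ a b (subst T (sym eq) tt)))
... | false = refl

diagAux-≤ : ∀ m s (f : ℕ → ℕ) → diagAux s (applyUpTo f m) ≤ m
diagAux-≤ zero    s f = z≤n
diagAux-≤ (suc m) s f with suc s ≤? f 0
... | yes p rewrite indicator-yes (suc s) (f 0) p = s≤s (diagAux-≤ m (suc s) (f ∘ suc))
... | no p  rewrite indicator-no (suc s) (f 0) p  = m≤n⇒m≤1+n (diagAux-≤ m (suc s) (f ∘ suc))

diagAux-sound : ∀ m s (f : ℕ → ℕ) → Antitone f →
  ∀ i → i < diagAux s (applyUpTo f m) → suc (s + i) ≤ f i
diagAux-sound (suc m) s f A i lt with suc s ≤? f 0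
diagAux-sound (suc m) s f A zero    lt | yes p rewrite +-identityʳ s = p
diagAux-sound (suc m) s f A (suc i) lt | yes p rewrite indicator-yes (suc s) (f 0) p | +-suc s i =
  diagAux-sound m (suc s) (f ∘ suc) (A ∘ suc) i (≤-pred lt)
diagAux-sound (suc m) s f A i lt | no p rewrite indicator-no (suc s) (f 0) p =
  ⊥-elim (p (≤-trans (s≤s (≤-trans (m≤m+n s 0) (n≤1+n (s + 0))))
            (≤-trans (diagAux-sound m (suc s) (f ∘ suc) (A ∘ suc) 0 (≤-<-trans z≤n lt)) (A 0))))

diagAux-complete : ∀ m s (f : ℕ → ℕ) → Antitone f →
  ∀ i → i < m → suc (s + i) ≤ f i → i < diagAux s (applyUpTo f m)
diagAux-complete (suc m) s f A i lt c with suc s ≤? f 0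
diagAux-complete (suc m) s f A zero    lt c | yes p rewrite indicator-yes (suc s) (f 0) p = s≤s z≤n
diagAux-complete (suc m) s f A (suc i) lt c | yes p rewrite indicator-yes (suc s) (f 0) p =
  s≤s (diagAux-complete m (suc s) (f ∘ suc) (A ∘ suc) i (≤-pred lt)
        (subst (λ x → suc x ≤ f (suc i)) (+-suc s i) c))
diagAux-complete (suc m) s f A i lt c | no p =
  ⊥-elim (p (≤-trans (s≤s (m≤m+n s i)) (≤-trans c (antitone A z≤n))))

countAux-≤ : ∀ m t (g : ℕ → ℕ) → countAux t (applyUpTo g m) ≤ m
countAux-≤ zero    t g = z≤n
countAux-≤ (suc m) t g with t ≤? g 0
... | yes p rewrite indicator-yes t (g 0) p = s≤s (countAux-≤ m t (g ∘ suc))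
... | no p  rewrite indicator-no t (g 0) p  = m≤n⇒m≤1+n (countAux-≤ m t (g ∘ suc))

countAux-sound : ∀ m t (g : ℕ → ℕ) → Antitone g →
  ∀ i → i < countAux t (applyUpTo g m) → t ≤ g i
countAux-sound (suc m) t g A i lt with t ≤? g 0
countAux-sound (suc m) t g A zero    lt | yes p = p
countAux-sound (suc m) t g A (suc i) lt | yes p rewrite indicator-yes t (g 0) p =
  countAux-sound m t (g ∘ suc) (A ∘ suc) i (≤-pred lt)
countAux-sound (suc m) t g A i lt | no p rewrite indicator-no t (g 0) p =
  ⊥-elim (p (≤-trans (countAux-sound m t (g ∘ suc) (A ∘ suc) 0 (≤-<-trans z≤n lt)) (A 0)))

countAux-complete : ∀ m t (g : ℕ → ℕ) → Antitone g →
  ∀ i → i < m → t ≤ g i → i < countAux t (applyUpTo g m)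
countAux-complete (suc m) t g A i lt c with t ≤? g 0
countAux-complete (suc m) t g A zero    lt c | yes p rewrite indicator-yes t (g 0) p = s≤s z≤n
countAux-complete (suc m) t g A (suc i) lt c | yes p rewrite indicator-yes t (g 0) p =
  s≤s (countAux-complete m t (g ∘ suc) (A ∘ suc) i (≤-pred lt) c)
countAux-complete (suc m) t g A i lt c | no p = ⊥-elim (p (≤-trans c (antitone A z≤n)))

module Conjugate (m t : ℕ) (ρ : List ℕ) (P : IsPartition ρ) where

  conj-≤ : conj m ρ t ≤ m
  conj-≤ = subst (λ l → countAux t l ≤ m) (sym (rows≡applyUpTo m ρ)) (countAux-≤ m t (row ρ))

  conj-sound : ∀ j → j < conj m ρ t → t ≤ row ρ j
  conj-sound j lt =
    countAux-sound m t (row ρ) P j (subst (λ l → j < countAux t l) (rows≡applyUpTo m ρ) lt)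

  conj-complete : ∀ j → j < m → t ≤ row ρ j → j < conj m ρ t
  conj-complete j j<m c =
    subst (λ l → j < countAux t l) (sym (rows≡applyUpTo m ρ)) (countAux-complete m t (row ρ) P j j<m c)

-- The diagonal of the complement λ^{∨_r}.  Its q-th row (from the bottom)
-- is r − λ_{j+1} where q + 1 + j = m, so q < diag₀(λ^{∨_r}) iff
-- q + 1 ≤ r − λ_{j+1}.
module ComplementDiagonal (m r : ℕ) (lam : List ℕ) (P : IsPartition lam) where

  private
    entry : ℕ → ℕ
    entry i = r ∸ row lam (m ∸ suc i)

    entry-antitone : Antitone entry
    entry-antitone i = ∸-monoʳ-≤ r (rows-antitone lam P (∸-monoʳ-≤ m (n≤1+n (suc i))))

    complement≡ : complement m r lam ≡ applyUpTo entry m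
    complement≡ = map-applyUpTo (λ x → x) entry m

  diag-≤ : diag₀ (complement m r lam) ≤ m
  diag-≤ rewrite complement≡ = diagAux-≤ m 0 entry

  diag-sound : ∀ q j → suc (q + j) ≡ m → q < diag₀ (complement m r lam) → suc q ≤ r ∸ row lam j
  diag-sound q j e lt = subst (λ x → suc q ≤ r ∸ row lam x) (∸-split q j m e)
    (diagAux-sound m 0 entry entry-antitone q (subst (λ l → q < diagAux 0 l) complement≡ lt))

  diag-complete : ∀ q j → suc (q + j) ≡ m → suc q ≤ r ∸ row lam j → q < diag₀ (complement m r lam)
  diag-complete q j e c = subst (λ l → q < diagAux 0 l) (sym complement≡)
    (diagAux-complete m 0 entry entry-antitone q (subst (suc q ≤_) e (s≤s (m≤m+n q j)))
      (subst (λ x → suc q ≤ r ∸ row lam x) (sym (∸-split q j m e)) c))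

-- Bit strings.  onesBefore q b is the number of ones preceding the
-- (q+1)-th zero of b (or all ones of b if it has at most q zeros).

onesBefore : ℕ → List Bool → ℕ
onesBefore q       []          = 0
onesBefore q       (true ∷ b)  = suc (onesBefore q b)
onesBefore zero    (false ∷ b) = 0
onesBefore (suc q) (false ∷ b) = onesBefore q b

zeros : List Bool → ℕ
zeros []          = 0
zeros (true ∷ b)  = zeros b
zeros (false ∷ b) = suc (zeros b)

ones : List Bool → ℕ
ones []          = 0
ones (true ∷ b)  = suc (ones b)
ones (false ∷ b) = ones b

onesBefore-ones++ : ∀ a q b → onesBefore q (replicate a true ++ b) ≡ a + onesBefore q b
onesBefore-ones++ zero    q b = refl
onesBefore-ones++ (suc a) q b = cong suc (onesBefore-ones++ a q b)

onesBefore-++ˡ : ∀ xs ys q → q < zeros xs → onesBefore q (xs ++ ys) ≡ onesBefore q xs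
onesBefore-++ˡ (true ∷ xs)  ys q       lt       = cong suc (onesBefore-++ˡ xs ys q lt)
onesBefore-++ˡ (false ∷ xs) ys zero    lt       = refl
onesBefore-++ˡ (false ∷ xs) ys (suc q) (s≤s lt) = onesBefore-++ˡ xs ys q lt

onesBefore-++ʳ : ∀ xs ys q → onesBefore (zeros xs + q) (xs ++ ys) ≡ ones xs + onesBefore q ys
onesBefore-++ʳ []           ys q = refl
onesBefore-++ʳ (true ∷ xs)  ys q = cong suc (onesBefore-++ʳ xs ys q)
onesBefore-++ʳ (false ∷ xs) ys q = onesBefore-++ʳ xs ys q

zeros-++ : ∀ xs ys → zeros (xs ++ ys) ≡ zeros xs + zeros ys
zeros-++ []           ys = refl
zeros-++ (true ∷ xs)  ys = zeros-++ xs ys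
zeros-++ (false ∷ xs) ys = cong suc (zeros-++ xs ys)

ones-++ : ∀ xs ys → ones (xs ++ ys) ≡ ones xs + ones ys
ones-++ []           ys = refl
ones-++ (true ∷ xs)  ys = cong suc (ones-++ xs ys)
ones-++ (false ∷ xs) ys = ones-++ xs ys

zeros-ones : ∀ a → zeros (replicate a true) ≡ 0
zeros-ones zero    = refl
zeros-ones (suc a) = zeros-ones a

ones-ones : ∀ a → ones (replicate a true) ≡ a
ones-ones zero    = refl
ones-ones (suc a) = cong suc (ones-ones a)

length≡zeros+ones : ∀ b → length b ≡ zeros b + ones b
length≡zeros+ones []          = refl
length≡zeros+ones (true ∷ b)  = trans (cong suc (length≡zeros+ones b)) (sym (+-suc (zeros b) (ones b)))
length≡zeros+ones (false ∷ b) = cong suc (length≡zeros+ones b)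

-- The (q+1)-th zero of b sits at position q + onesBefore q b, so it lies
-- among the first r bits iff that position is < r.
zero-in-prefix⇒ : ∀ b r q → q < zeros b → q < zeros (take r b) → q + onesBefore q b < r
zero-in-prefix⇒ (true ∷ b)  (suc r) q       l1       l2 rewrite +-suc q (onesBefore q b) =
  s≤s (zero-in-prefix⇒ b r q l1 l2)
zero-in-prefix⇒ (false ∷ b) (suc r) zero    l1       l2       = s≤s z≤n
zero-in-prefix⇒ (false ∷ b) (suc r) (suc q) (s≤s l1) (s≤s l2) = s≤s (zero-in-prefix⇒ b r q l1 l2)

zero-in-prefix⇐ : ∀ b r q → q < zeros b → q + onesBefore q b < r → q < zeros (take r b)
zero-in-prefix⇐ (true ∷ b)  (suc r) q       l1       l2 rewrite +-suc q (onesBefore q b) =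
  zero-in-prefix⇐ b r q l1 (≤-pred l2)
zero-in-prefix⇐ (false ∷ b) (suc r) zero    l1       l2       = s≤s z≤n
zero-in-prefix⇐ (false ∷ b) (suc r) (suc q) (s≤s l1) (s≤s l2) = s≤s (zero-in-prefix⇐ b r q l1 l2)

module PartitionBits (m r : ℕ) (ν : List ℕ) (box : InBox m r ν) where

  private
    P : IsPartition ν
    P = proj₁ box
    ≤r : ∀ i → row ν i ≤ r
    ≤r = proj₁ (proj₂ box)
    =0 : ∀ i → m ≤ i → row ν i ≡ 0
    =0 = proj₂ (proj₂ box)

    descent : ℕ → ℕ
    descent k = row ν k ∸ row ν (suc k)

    zeros-bitsAux : ∀ k → zeros (bitsAux ν k) ≡ k
    zeros-bitsAux zero = refl
    zeros-bitsAux (suc k) rewrite zeros-++ (replicate (descent k) true) (false ∷ bitsAux ν k)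
      | zeros-ones (descent k) = cong suc (zeros-bitsAux k)

    ones-bitsAux : ∀ k → ones (bitsAux ν k) + row ν k ≡ row ν 0
    ones-bitsAux zero = refl
    ones-bitsAux (suc k) rewrite ones-++ (replicate (descent k) true) (false ∷ bitsAux ν k)
      | ones-ones (descent k) = begin
        descent k + ones (bitsAux ν k) + row ν (suc k)
      ≡⟨ xy∙z≈xz∙y (descent k) (ones (bitsAux ν k)) (row ν (suc k)) ⟩
        descent k + row ν (suc k) + ones (bitsAux ν k)
      ≡⟨ cong (_+ ones (bitsAux ν k)) (m∸n+n≡m (P k)) ⟩
        row ν k + ones (bitsAux ν k)
      ≡⟨ +-comm (row ν k) _ ⟩
        ones (bitsAux ν k) + row ν k
      ≡⟨ ones-bitsAux k ⟩
        row ν 0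
      ∎
      where open ≡-Reasoning

    onesBefore-bitsAux : ∀ q j → onesBefore q (bitsAux ν (suc (q + j))) + row ν (suc (q + j)) ≡ row ν j
    onesBefore-bitsAux zero j
      rewrite onesBefore-ones++ (descent j) 0 (false ∷ bitsAux ν j) | +-identityʳ (descent j) = m∸n+n≡m (P j)
    onesBefore-bitsAux (suc q) j
      rewrite onesBefore-ones++ (descent (suc (q + j))) (suc q) (false ∷ bitsAux ν (suc (q + j))) = begin
        descent k + X + row ν (suc k)
      ≡⟨ xy∙z≈xz∙y (descent k) X (row ν (suc k)) ⟩
        descent k + row ν (suc k) + X
      ≡⟨ cong (_+ X) (m∸n+n≡m (P k)) ⟩
        row ν k + X
      ≡⟨ +-comm (row ν k) X ⟩
        X + row ν k
      ≡⟨ onesBefore-bitsAux q j ⟩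
        row ν j
      ∎
      where
      open ≡-Reasoning
      k : ℕ
      k = suc (q + j)
      X : ℕ
      X = onesBefore q (bitsAux ν k)

  zeros-bits : zeros (bits m r ν) ≡ m
  zeros-bits rewrite zeros-++ (bitsAux ν m) (replicate (r ∸ row ν 0) true)
    | zeros-ones (r ∸ row ν 0) | zeros-bitsAux m = +-identityʳ m

  ones-bits : ones (bits m r ν) ≡ r
  ones-bits rewrite ones-++ (bitsAux ν m) (replicate (r ∸ row ν 0) true)
    | ones-ones (r ∸ row ν 0) = trans (cong (_+ (r ∸ row ν 0)) ones-top) (m+[n∸m]≡n (≤r 0))
    where
    ones-top : ones (bitsAux ν m) ≡ row ν 0
    ones-top = trans (sym (+-identityʳ _))
      (trans (cong (ones (bitsAux ν m) +_) (sym (=0 m ≤-refl))) (ones-bitsAux m))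

  length-bits : length (bits m r ν) ≡ m + r
  length-bits rewrite length≡zeros+ones (bits m r ν) | zeros-bits | ones-bits = refl

  onesBefore-bits : ∀ q j → suc (q + j) ≡ m → onesBefore q (bits m r ν) ≡ row ν j
  onesBefore-bits q j e = begin
      onesBefore q (bits m r ν)
    ≡⟨ onesBefore-++ˡ (bitsAux ν m) (replicate (r ∸ row ν 0) true) q
         (subst (q <_) (sym (zeros-bitsAux m)) (subst (q <_) e (s≤s (m≤m+n q j)))) ⟩
      onesBefore q (bitsAux ν m)
    ≡⟨ sym (+-identityʳ _) ⟩
      onesBefore q (bitsAux ν m) + 0
    ≡⟨ cong (onesBefore q (bitsAux ν m) +_) (sym (=0 m ≤-refl)) ⟩
      onesBefore q (bitsAux ν m) + row ν m
    ≡⟨ subst (λ k → onesBefore q (bitsAux ν k) + row ν k ≡ row ν j) e (onesBefore-bitsAux q j) ⟩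
      row ν j
    ∎
    where open ≡-Reasoning

module Diagonal (m r : ℕ) (ν : List ℕ) (box : InBox m r ν) where

  P : IsPartition ν
  P = proj₁ box
  ≤r : ∀ i → row ν i ≤ r
  ≤r = proj₁ (proj₂ box)
  =0 : ∀ i → m ≤ i → row ν i ≡ 0
  =0 = proj₂ (proj₂ box)

  open ComplementDiagonal m r ν P

  D : ℕ
  D = diag₀ (complement m r ν)

  D≤m : D ≤ m
  D≤m = diag-≤

  below-diagonal⇒ : ∀ q j → suc (q + j) ≡ m → q < D → suc q + row ν j ≤ r
  below-diagonal⇒ q j e q<D = m≤o∸n⇒m+n≤o (suc q) (≤r j) (diag-sound q j e q<D)

  below-diagonal⇐ : ∀ q j → suc (q + j) ≡ m → suc q + row ν j ≤ r → q < D
  below-diagonal⇐ q j e c = diag-complete q j e (m+n≤o⇒m≤o∸n (suc q) c)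

  top-rows : ∀ i → m ≤ D + i → row ν i + D ≤ r
  top-rows i = go D refl
    where
    go : ∀ x → x ≡ D → m ≤ x + i → row ν i + x ≤ r
    go zero    _   m≤i rewrite =0 i m≤i = z≤n
    go (suc x) x<D m≤x+i with split< (≤-trans (≤-reflexive x<D) D≤m)
    ... | j , e = ≤-trans (+-monoˡ-≤ (suc x) (rows-antitone ν P j≤i))
                    (subst (_≤ r) (+-comm (suc x) (row ν j))
                      (below-diagonal⇒ x j e (subst (x <_) x<D ≤-refl)))
      where
      j≤i : j ≤ i
      j≤i = +-cancelˡ-≤ (suc x) j i (≤-trans (≤-reflexive e) m≤x+i)

  D≤r : D ≤ r
  D≤r = ≤-trans (m≤n+m D (row ν m)) (top-rows m (m≤n+m m D))

-- ρ = φ^r(ν): with b = b_ν = B₁ ++ B₂ where B₁ = take r b, the bit string of ρ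
-- is B₂ ++ B₁.  B₁ contains exactly D zeros, and reading off the ones before
-- each zero of B₂ ++ B₁ expresses ρ through ν.
module Rotation (m r : ℕ) (ν : List ℕ) (box : InBox m r ν) (ρ : List ℕ) (boxρ : InBox m r ρ)
                (b-rot : bits m r ρ ≡ rotate r (bits m r ν)) where

  open Diagonal m r ν box public
  private
    module Bν = PartitionBits m r ν box
    module Bρ = PartitionBits m r ρ boxρ

    b : List Bool
    b = bits m r ν
    B₁ : List Bool
    B₁ = take r b
    B₂ : List Bool
    B₂ = drop r b

    B₁++B₂ : B₁ ++ B₂ ≡ b
    B₁++B₂ = take++drop≡id r b

    zeros-B₁+B₂ : zeros B₁ + zeros B₂ ≡ m
    zeros-B₁+B₂ = trans (sym (zeros-++ B₁ B₂)) (trans (cong zeros B₁++B₂) Bν.zeros-bits)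

    ones-B₁+B₂ : ones B₁ + ones B₂ ≡ r
    ones-B₁+B₂ = trans (sym (ones-++ B₁ B₂)) (trans (cong ones B₁++B₂) Bν.ones-bits)

    length-B₁ : length B₁ ≡ r
    length-B₁ = trans (length-take r b) (trans (cong (r ⊓_) Bν.length-bits) (m≤n⇒m⊓n≡m (m≤n+m r m)))

    -- the (k+1)-th zero of b lies in B₁ iff k < D
    zeros-B₁ : zeros B₁ ≡ D
    zeros-B₁ = threshold-unique m (zeros B₁) D (subst (zeros B₁ ≤_) zeros-B₁+B₂ (m≤m+n _ _)) D≤m B₁⊆D D⊆B₁
      where
      B₁⊆D : ∀ k → k < m → k < zeros B₁ → k < D
      B₁⊆D k k<m k<B₁ with split< k<m
      ... | j , e = below-diagonal⇐ k j e (subst (λ x → k + x < r) (Bν.onesBefore-bits k j e)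
                      (zero-in-prefix⇒ b r k (subst (k <_) (sym Bν.zeros-bits) k<m) k<B₁))
      D⊆B₁ : ∀ k → k < m → k < D → k < zeros B₁
      D⊆B₁ k k<m k<D with split< k<m
      ... | j , e = zero-in-prefix⇐ b r k (subst (k <_) (sym Bν.zeros-bits) k<m)
                      (subst (λ x → k + x < r) (sym (Bν.onesBefore-bits k j e)) (below-diagonal⇒ k j e k<D))

    ones-B₁ : ones B₁ + D ≡ r
    ones-B₁ = trans (+-comm (ones B₁) D)
      (trans (cong (_+ ones B₁) (sym zeros-B₁)) (trans (sym (length≡zeros+ones B₁)) length-B₁))

    zeros-B₂ : D + zeros B₂ ≡ m
    zeros-B₂ = trans (cong (_+ zeros B₂) (sym zeros-B₁)) zeros-B₁+B₂

    ones-B₂ : ones B₂ ≡ D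
    ones-B₂ = +-cancelˡ-≡ (ones B₁) (ones B₂) D (trans ones-B₁+B₂ (sym ones-B₁))

    onesBefore-ρ : ∀ q j → suc (q + j) ≡ m → onesBefore q (B₂ ++ B₁) ≡ row ρ j
    onesBefore-ρ q j e = trans (cong (onesBefore q) (sym b-rot)) (Bρ.onesBefore-bits q j e)

  rotation-low : ∀ j → j < D → row ρ j ≡ D + row ν ((m ∸ D) + j)
  rotation-low j j<D with split< j<D
  ... | q , e = begin
      row ρ j
    ≡⟨ sym (onesBefore-ρ (z + q) j e₁) ⟩
      onesBefore (z + q) (B₂ ++ B₁)
    ≡⟨ onesBefore-++ʳ B₂ B₁ q ⟩
      ones B₂ + onesBefore q B₁
    ≡⟨ cong₂ _+_ ones-B₂ (sym (onesBefore-++ˡ B₁ B₂ q q<zB₁)) ⟩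
      D + onesBefore q (B₁ ++ B₂)
    ≡⟨ cong (λ x → D + onesBefore q x) B₁++B₂ ⟩
      D + onesBefore q b
    ≡⟨ cong (D +_) (Bν.onesBefore-bits q (z + j) e₂) ⟩
      D + row ν (z + j)
    ≡⟨ cong (λ x → D + row ν (x + j)) (sym m∸D) ⟩
      D + row ν ((m ∸ D) + j)
    ∎
    where
    open ≡-Reasoning
    z : ℕ
    z = zeros B₂
    m∸D : m ∸ D ≡ z
    m∸D = trans (cong (_∸ D) (sym zeros-B₂)) (m+n∸m≡n D z)
    z+D : z + D ≡ m
    z+D = trans (+-comm z D) zeros-B₂
    e₁ : suc ((z + q) + j) ≡ m
    e₁ = trans (cong suc (trans (+-assoc z q j) (cong (z +_) (+-comm q j))))
           (trans (sym (+-suc z (j + q))) (trans (cong (z +_) e) z+D))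
    e₂ : suc (q + (z + j)) ≡ m
    e₂ = trans (cong suc (trans (x∙yz≈y∙xz q z j) (cong (z +_) (+-comm q j))))
           (trans (sym (+-suc z (j + q))) (trans (cong (z +_) e) z+D))
    q<zB₁ : q < zeros B₁
    q<zB₁ = subst (q <_) (sym zeros-B₁) (subst (q <_) e (s≤s (m≤n+m q j)))

  rotation-high : ∀ j → D + j < m → row ρ (D + j) + r ≡ row ν j + D
  rotation-high j D+j<m with split< D+j<m
  ... | q , e = begin
      row ρ (D + j) + r
    ≡⟨ cong₂ _+_ (sym (trans (sym (onesBefore-++ˡ B₂ B₁ q q<zB₂)) (onesBefore-ρ q (D + j) e₁))) (sym ones-B₁) ⟩
      onesBefore q B₂ + (ones B₁ + D)
    ≡⟨ x∙yz≈yx∙z (onesBefore q B₂) (ones B₁) D ⟩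
      (ones B₁ + onesBefore q B₂) + D
    ≡⟨ cong (_+ D) (sym (onesBefore-++ʳ B₁ B₂ q)) ⟩
      onesBefore (zeros B₁ + q) (B₁ ++ B₂) + D
    ≡⟨ cong₂ (λ x y → onesBefore (x + q) y + D) zeros-B₁ B₁++B₂ ⟩
      onesBefore (D + q) b + D
    ≡⟨ cong (_+ D) (Bν.onesBefore-bits (D + q) j e₂) ⟩
      row ν j + D
    ∎
    where
    open ≡-Reasoning
    e₁ : suc (q + (D + j)) ≡ m
    e₁ = trans (cong suc (+-comm q (D + j))) e
    e₂ : suc ((D + q) + j) ≡ m
    e₂ = trans (cong suc (xy∙z≈xz∙y D q j)) e
    q<zB₂ : q < zeros B₂
    q<zB₂ = +-cancelˡ-< D q (zeros B₂)
      (subst (D + q <_) (sym zeros-B₂) (≤-trans (s≤s (m≤m+n (D + q) j)) (≤-reflexive e₂)))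

prefixSum : (ℕ → ℕ) → ℕ → ℕ
prefixSum f zero    = 0
prefixSum f (suc L) = prefixSum f L + f L

prefixSum-suc : ∀ f L → prefixSum f (suc L) ≡ f 0 + prefixSum (f ∘ suc) L
prefixSum-suc f zero    = +-comm 0 (f 0)
prefixSum-suc f (suc L) = trans (cong (_+ f (suc L)) (prefixSum-suc f L)) (+-assoc (f 0) _ _)

prefixSum-zero : ∀ L → prefixSum (row []) L ≡ 0
prefixSum-zero zero    = refl
prefixSum-zero (suc L) = trans (+-identityʳ _) (prefixSum-zero L)

sum≡prefixSum : ∀ lam L → length lam ≤ L → sum lam ≡ prefixSum (row lam) L
sum≡prefixSum []        L       _       = sym (prefixSum-zero L)
sum≡prefixSum (x ∷ lam) (suc L) (s≤s p) =
  trans (cong (x +_) (sum≡prefixSum lam L p)) (sym (prefixSum-suc (row (x ∷ lam)) L))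

prefixSum-cong : ∀ f g L → (∀ i → i < L → f i ≡ g i) → prefixSum f L ≡ prefixSum g L
prefixSum-cong f g zero    _  = refl
prefixSum-cong f g (suc L) eq =
  cong₂ _+_ (prefixSum-cong f g L (λ i p → eq i (m≤n⇒m≤1+n p))) (eq L ≤-refl)

prefixSum-growth≤ : ∀ f g → (∀ i → g i ≤ f i) → ∀ J x →
  prefixSum f J + prefixSum g (J + x) ≤ prefixSum f (J + x) + prefixSum g J
prefixSum-growth≤ f g g≤f J zero rewrite +-identityʳ J = ≤-refl
prefixSum-growth≤ f g g≤f J (suc x) rewrite +-suc J x =
  ≤-trans (≤-reflexive (sym (+-assoc (prefixSum f J) (prefixSum g (J + x)) (g (J + x)))))
  (≤-trans (+-mono-≤ (prefixSum-growth≤ f g g≤f J x) (g≤f (J + x)))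
  (≤-reflexive (xy∙z≈xz∙y (prefixSum f (J + x)) (prefixSum g J) (f (J + x)))))

prefixSum-growth≡ : ∀ f g J → (∀ i → J ≤ i → f i ≡ g i) → ∀ x →
  prefixSum f (J + x) + prefixSum g J ≡ prefixSum f J + prefixSum g (J + x)
prefixSum-growth≡ f g J eq zero rewrite +-identityʳ J = refl
prefixSum-growth≡ f g J eq (suc x) rewrite +-suc J x = begin
    prefixSum f (J + x) + f (J + x) + prefixSum g J
  ≡⟨ xy∙z≈xz∙y (prefixSum f (J + x)) (f (J + x)) (prefixSum g J) ⟩
    prefixSum f (J + x) + prefixSum g J + f (J + x)
  ≡⟨ cong₂ _+_ (prefixSum-growth≡ f g J eq x) (eq (J + x) (m≤m+n J x)) ⟩
    prefixSum f J + prefixSum g (J + x) + g (J + x)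
  ≡⟨ +-assoc (prefixSum f J) _ _ ⟩
    prefixSum f J + (prefixSum g (J + x) + g (J + x))
  ∎
  where open ≡-Reasoning

-- Let the head
-- lie in row hd (0-based), λ = row lam, μ = row μ.  The hook is connected without 2×2
-- squares, so every row j > hd it meets satisfies λ_{j+1} = μ_j + 1 and
-- the rows it meets are consecutive.  Counting its n cells then shows that
-- it meets exactly the rows hd + 1, …, hd + m when μ has no row hd + m.
module RimHook (m r n : ℕ) (n≡m+r : n ≡ m + r) (μ lam : List ℕ) (Pμ : IsPartition μ)
               (H : AddRimHook n r μ lam) where

  private
    S : Cell → Set
    S = InSkew lam μ
    Plam : IsPartition lam
    Plam = proj₁ H
    μ⊆λ : μ ⊆ₚ lam
    μ⊆λ = proj₁ (proj₂ H)
    size : sum μ + n ≡ sum lam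
    size = proj₁ (proj₂ (proj₂ H))
    connected : Connected S
    connected = proj₁ (proj₂ (proj₂ (proj₂ H)))
    no2x2 : No2x2 S
    no2x2 = proj₁ (proj₂ (proj₂ (proj₂ (proj₂ H))))
    head : HeadInColumn r S
    head = proj₂ (proj₂ (proj₂ (proj₂ (proj₂ H))))

  L M : ℕ → ℕ
  L = row lam
  M = row μ

  hd : ℕ
  hd = proj₁ (proj₁ head)

  private
    hc : ℕ
    hc = proj₂ (proj₁ head)
    head∈S : S (hd , hc)
    head∈S = proj₁ (proj₂ head)
    hc+1≡r : suc hc ≡ r
    hc+1≡r = proj₁ (proj₂ (proj₂ head))
    southeast : ∀ c → S c → (hd ≤ proj₁ c) × (proj₂ c ≤ hc)
    southeast = proj₂ (proj₂ (proj₂ head))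

  head-fits : M hd < r
  head-fits = subst (M hd <_) hc+1≡r (s≤s (proj₁ head∈S))

  rows-below-head : ∀ j → j < hd → L j ≡ M j
  rows-below-head j j<hd with M j <? L j
  ... | yes p = ⊥-elim (<-irrefl refl (<-≤-trans j<hd (proj₁ (southeast (j , M j) (≤-refl , p)))))
  ... | no p  = ≤-antisym (≮⇒≥ p) (μ⊆λ j)

  head-row : L hd ≡ r
  head-row with suc hc <? L hd
  ... | yes p = ⊥-elim (<-irrefl refl (proj₂ (southeast (hd , suc hc) (≤-trans (proj₁ head∈S) (n≤1+n hc) , p))))
  ... | no p  = subst (L hd ≡_) hc+1≡r (≤-antisym (≮⇒≥ p) (proj₂ head∈S))

  full-below-head : ∀ j → j < hd → r ≤ M j
  full-below-head j j<hd = subst (r ≤_) (rows-below-head j j<hd)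
    (subst (_≤ L j) head-row (rows-antitone lam Plam (<⇒≤ j<hd)))

  -- no 2×2 square: row j + 1 of λ overhangs row j of μ by at most one cell
  overhang≤1 : ∀ j → L (suc j) ≤ suc (M j)
  overhang≤1 j with L (suc j) ≤? suc (M j)
  ... | yes p = p
  ... | no p  = ⊥-elim (no2x2 (j , M j , c₁ , c₂ , c₃ , c₄))
    where
    q : suc (suc (M j)) ≤ L (suc j)
    q = ≰⇒> p
    q′ : suc (suc (M j)) ≤ L j
    q′ = ≤-trans q (Plam j)
    c₁ : S (j , M j)
    c₁ = ≤-refl , ≤-trans (n≤1+n _) q′
    c₂ : S (suc j , M j)
    c₂ = Pμ j , ≤-trans (n≤1+n _) q
    c₃ : S (j , suc (M j))
    c₃ = n≤1+n _ , q′
    c₄ : S (suc j , suc (M j))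
    c₄ = ≤-trans (Pμ j) (n≤1+n _) , q

  path-crosses : ∀ j {a b} → Reach S a b → S a → proj₁ a ≤ j → suc j ≤ proj₁ b →
                 Σ ℕ λ x → S (j , x) × S (suc j , x)
  path-crosses j here Sa a≤j j<b = ⊥-elim (<-irrefl refl (≤-trans j<b a≤j))
  path-crosses j {i , x} (step {c' = i′ , x′} adj Sc′ rest) Sa i≤j j<b with suc j ≤? i′
  ... | no p = path-crosses j rest Sc′ (≮⇒≥ p) j<b
  ... | yes p with adj
  ...   | inj₁ (refl , _)        = ⊥-elim (<-irrefl refl (≤-trans p i≤j))
  ...   | inj₂ (refl , inj₂ refl) = ⊥-elim (<-irrefl refl (≤-trans p (≤-trans (n≤1+n i′) i≤j)))
  ...   | inj₂ (refl , inj₁ refl) with ≤-antisym i≤j (≤-pred p)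
  ...     | refl = x , Sa , Sc′

  Occupied : ℕ → Set
  Occupied j = M j < L j

  occupied? : ∀ i → Occupied i ⊎ L i ≡ M i
  occupied? i with M i <? L i
  ... | yes p = inj₁ p
  ... | no p  = inj₂ (≤-antisym (≮⇒≥ p) (μ⊆λ i))

  -- above the head, an occupied row j + 1 is joined to the head through
  -- row j, so it overlaps row j of μ
  joins-below : ∀ j → hd ≤ j → Occupied (suc j) → suc (M j) ≤ L (suc j)
  joins-below j hd≤j occ with path-crosses j (connected (hd , hc) (suc j , M (suc j)) head∈S (≤-refl , occ)) head∈S hd≤j ≤-refl
  ... | x , (x∈j , _) , (_ , x∈j+1) = ≤-trans (s≤s x∈j) x∈j+1

  occupied-row : ∀ j → hd ≤ j → Occupied (suc j) → L (suc j) ≡ suc (M j)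
  occupied-row j hd≤j occ = ≤-antisym (overhang≤1 j) (joins-below j hd≤j occ)

  occupied-below : ∀ j → hd ≤ j → Occupied (suc j) → Occupied j
  occupied-below j hd≤j occ = ≤-trans (joins-below j hd≤j occ) (Plam j)

  occupied-below* : ∀ k x → Occupied (hd + (k + x)) → Occupied (hd + k)
  occupied-below* k zero    occ rewrite +-identityʳ k = occ
  occupied-below* k (suc x) occ rewrite +-suc k x | +-suc hd (k + x) =
    occupied-below* k x (occupied-below (hd + (k + x)) (m≤m+n hd _) occ)

  occupied-head : Occupied hd
  occupied-head = subst (M hd <_) (sym head-row) head-fits

  cells≤ : ∀ k → prefixSum L (suc (hd + k)) + M (hd + k) ≤ prefixSum M (suc (hd + k)) + (r + k)
  cells≡ : ∀ k → (∀ k′ → k′ < k → Occupied (suc (hd + k′))) →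
           prefixSum L (suc (hd + k)) + M (hd + k) ≡ prefixSum M (suc (hd + k)) + (r + k)

  cells-head : prefixSum L (suc hd) + M hd ≡ prefixSum M (suc hd) + r
  cells-head = begin
      prefixSum L hd + L hd + M hd
    ≡⟨ cong₂ (λ a b → a + b + M hd) (prefixSum-cong L M hd rows-below-head) head-row ⟩
      prefixSum M hd + r + M hd
    ≡⟨ xy∙z≈xz∙y (prefixSum M hd) r (M hd) ⟩
      prefixSum M hd + M hd + r
    ∎
    where open ≡-Reasoning

  cells≤ zero rewrite +-identityʳ hd | +-identityʳ r = ≤-reflexive cells-head
  cells≤ (suc k) rewrite +-suc hd k | +-suc r k = begin
      A + L (suc j) + M (suc j)
    ≤⟨ +-monoˡ-≤ (M (suc j)) (+-monoʳ-≤ A (overhang≤1 j)) ⟩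
      A + suc (M j) + M (suc j)
    ≡⟨ cong (_+ M (suc j)) (+-suc A (M j)) ⟩
      suc (A + M j) + M (suc j)
    ≤⟨ +-monoˡ-≤ (M (suc j)) (s≤s (cells≤ k)) ⟩
      suc (B + (r + k)) + M (suc j)
    ≡⟨ regroup B (r + k) (M (suc j)) ⟩
      B + M (suc j) + suc (r + k)
    ∎
    where
    open ≤-Reasoning
    j : ℕ
    j = hd + k
    A : ℕ
    A = prefixSum L (suc j)
    B : ℕ
    B = prefixSum M (suc j)
    regroup : ∀ a b c → suc (a + b) + c ≡ a + c + suc b
    regroup = solve-∀

  cells≡ zero _ rewrite +-identityʳ hd | +-identityʳ r = cells-head
  cells≡ (suc k) occ rewrite +-suc hd k | +-suc r k = begin
      A + L (suc j) + M (suc j)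
    ≡⟨ cong (λ x → A + x + M (suc j)) (occupied-row j (m≤m+n hd k) (occ k ≤-refl)) ⟩
      A + suc (M j) + M (suc j)
    ≡⟨ cong (_+ M (suc j)) (+-suc A (M j)) ⟩
      suc (A + M j) + M (suc j)
    ≡⟨ cong (λ x → suc x + M (suc j)) (cells≡ k (λ k′ lt → occ k′ (m≤n⇒m≤1+n lt))) ⟩
      suc (B + (r + k)) + M (suc j)
    ≡⟨ regroup B (r + k) (M (suc j)) ⟩
      B + M (suc j) + suc (r + k)
    ∎
    where
    open ≡-Reasoning
    j : ℕ
    j = hd + k
    A : ℕ
    A = prefixSum L (suc j)
    B : ℕ
    B = prefixSum M (suc j)
    regroup : ∀ a b c → suc (a + b) + c ≡ a + c + suc b
    regroup = solve-∀

  -- the hook has n cells in all, hence at most n cells below any row J,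
  -- and exactly n if it has none from row J on
  private
    K₀ : ℕ
    K₀ = length μ + length lam

    size-total : ∀ K → K₀ ≤ K → prefixSum L K ≡ prefixSum M K + n
    size-total K K₀≤K =
      trans (sym (sum≡prefixSum lam K (≤-trans (m≤n+m (length lam) (length μ)) K₀≤K)))
        (trans (sym size) (cong (_+ n) (sum≡prefixSum μ K (≤-trans (m≤m+n (length μ) (length lam)) K₀≤K))))

  size-below≤ : ∀ J → prefixSum L J ≤ prefixSum M J + n
  size-below≤ J = +-cancelˡ-≤ (prefixSum M K) _ _ (begin
      prefixSum M K + prefixSum L J
    ≡⟨ +-comm (prefixSum M K) _ ⟩
      prefixSum L J + prefixSum M K
    ≤⟨ prefixSum-growth≤ L M μ⊆λ J K₀ ⟩
      prefixSum L K + prefixSum M J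
    ≡⟨ cong (_+ prefixSum M J) (size-total K (m≤n+m K₀ J)) ⟩
      prefixSum M K + n + prefixSum M J
    ≡⟨ xy∙z≈x∙zy (prefixSum M K) n (prefixSum M J) ⟩
      prefixSum M K + (prefixSum M J + n)
    ∎)
    where
    open ≤-Reasoning
    K : ℕ
    K = J + K₀

  size-below≡ : ∀ J → (∀ i → J ≤ i → L i ≡ M i) → prefixSum L J ≡ prefixSum M J + n
  size-below≡ J above = sym (+-cancelˡ-≡ (prefixSum M K) _ _ (begin
      prefixSum M K + (prefixSum M J + n)
    ≡⟨ sym (xy∙z≈x∙zy (prefixSum M K) n (prefixSum M J)) ⟩
      prefixSum M K + n + prefixSum M J
    ≡⟨ cong (_+ prefixSum M J) (sym (size-total K (m≤n+m K₀ J))) ⟩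
      prefixSum L K + prefixSum M J
    ≡⟨ prefixSum-growth≡ L M J above K₀ ⟩
      prefixSum L J + prefixSum M K
    ≡⟨ +-comm (prefixSum L J) _ ⟩
      prefixSum M K + prefixSum L J
    ∎))
    where
    open ≡-Reasoning
    K : ℕ
    K = J + K₀

  -- the hook reaches row hd + m: otherwise it would lie in rows < hd + m
  -- and have at most r + m − 1 < n cells
  reaches-row : Occupied (hd + m)
  reaches-row with occupied? (hd + m)
  ... | inj₁ occ = occ
  ... | inj₂ eq  = ⊥-elim (unoccupied m refl (<-irrefl (sym eq)))
    where
    unoccupied : ∀ k → k ≡ m → ¬ Occupied (hd + k) → ⊥
    unoccupied zero    _   ¬occ = ¬occ (subst Occupied (sym (+-identityʳ hd)) occupied-head)
    unoccupied (suc k) k≡m ¬occ = <-irrefl refl (≤-<-trans n≤r+k r+k<n)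
      where
      J : ℕ
      J = suc (hd + k)
      empty-above : ∀ i → J ≤ i → L i ≡ M i
      empty-above i J≤i with m≤n⇒∃[o]m+o≡n J≤i
      ... | x , refl with occupied? (J + x)
      ...   | inj₂ eq  = eq
      ...   | inj₁ occ = ⊥-elim (¬occ (occupied-below* (suc k) x
                           (subst Occupied (trans (cong suc (+-assoc hd k x)) (sym (+-suc hd (k + x)))) occ)))
      n≤r+k : n ≤ r + k
      n≤r+k = +-cancelˡ-≤ (prefixSum M J) n (r + k)
        (≤-trans (≤-reflexive (sym (size-below≡ J empty-above)))
          (≤-trans (m≤m+n (prefixSum L J) (M (hd + k))) (cells≤ k)))
      r+k<n : r + k < n
      r+k<n = subst (r + k <_) (sym (trans n≡m+r (cong (_+ r) (sym k≡m))))
                (≤-reflexive (cong suc (+-comm r k)))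

  module _ (μ-ends : M (hd + m) ≡ 0) where

    -- otherwise rows hd + 1, …, hd + m + 1 would hold r + m + 1 > n cells
    stops-after : ¬ Occupied (hd + suc m)
    stops-after occ = <-irrefl refl (≤-<-trans r+m+1≤n n<r+m+1)
      where
      J : ℕ
      J = suc (hd + suc m)
      all-occupied : ∀ k′ → k′ < suc m → Occupied (suc (hd + k′))
      all-occupied k′ lt with m≤n⇒∃[o]m+o≡n lt
      ... | x , e = subst Occupied (+-suc hd k′)
                      (occupied-below* (suc k′) x (subst (λ y → Occupied (hd + y)) (sym e) occ))
      μ-ends′ : M (hd + suc m) ≡ 0
      μ-ends′ = n≤0⇒n≡0 (subst (M (hd + suc m) ≤_) μ-ends (rows-antitone μ Pμ (+-monoʳ-≤ hd (n≤1+n m))))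
      cells : prefixSum L J ≡ prefixSum M J + (r + suc m)
      cells = trans (sym (+-identityʳ _)) (trans (cong (prefixSum L J +_) (sym μ-ends′)) (cells≡ (suc m) all-occupied))
      r+m+1≤n : r + suc m ≤ n
      r+m+1≤n = +-cancelˡ-≤ (prefixSum M J) (r + suc m) n (≤-trans (≤-reflexive (sym cells)) (size-below≤ J))
      n<r+m+1 : n < r + suc m
      n<r+m+1 = subst (_< r + suc m) (sym (trans n≡m+r (+-comm m r))) (≤-reflexive (sym (+-suc r m)))

    hook-rows : ∀ i → i < m → L (suc (hd + i)) ≡ suc (M (hd + i))
    hook-rows i i<m with m≤n⇒∃[o]m+o≡n i<m
    ... | x , e = occupied-row (hd + i) (m≤m+n hd i)
        (subst Occupied (+-suc hd i) (occupied-below* (suc i) x (subst (λ y → Occupied (hd + y)) (sym e) reaches-row)))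

    rows-above-hook : ∀ i → L (suc (hd + m + i)) ≡ M (suc (hd + m + i))
    rows-above-hook i with occupied? (suc (hd + m + i))
    ... | inj₂ eq  = eq
    ... | inj₁ occ = ⊥-elim (stops-after (occupied-below* (suc m) i (subst Occupied (reindex hd m i) occ)))
      where
      reindex : ∀ a b c → suc (a + b + c) ≡ a + (suc b + c)
      reindex = solve-∀

-- The shape of ν ⊕ d for d ≤ D: its first d rows equal r, its next m rows
-- are min(r, ν_{i+1} + d) and the rows above are the overflow
-- ν_{i+1} + d − r.  Each hook pushes the part of ν that sticks out of R_r
-- one step further: by induction on d, adding the (d+1)-th hook to this
-- shape raises rows d + 1, …, d + m + 1 appropriately.
module SumShape (m r n : ℕ) (n≡m+r : n ≡ m + r) (ν : List ℕ) (box : InBox m r ν) where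

  open Diagonal m r ν box

  N : ℕ → ℕ
  N = row ν

  record Shape (d : ℕ) (lam : List ℕ) : Set where
    field
      full     : ∀ j → j < d → row lam j ≡ r
      middle   : ∀ i → i < m → row lam (d + i) ≡ r ⊓ (N i + d)
      overflow : ∀ i → row lam (d + m + i) ≡ (N i + d) ∸ r

  shape-zero : Shape 0 ν
  shape-zero = record
    { full     = λ j ()
    ; middle   = λ i _ → sym (trans (cong (r ⊓_) (+-identityʳ (N i))) (m≥n⇒m⊓n≡n (≤r i)))
    ; overflow = λ i → trans (=0 (m + i) (m≤m+n m i))
                         (sym (m≤n⇒m∸n≡0 (subst (_≤ r) (sym (+-identityʳ (N i))) (≤r i))))
    }

  shape-≤r : ∀ d lam → d ≤ r → Shape d lam → ∀ j → row lam j ≤ r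
  shape-≤r d lam d≤r s j with j <? d
  ... | yes j<d = ≤-reflexive (Shape.full s j j<d)
  ... | no j≮d with m≤n⇒∃[o]m+o≡n (≮⇒≥ j≮d)
  ...   | k , refl with k <? m
  ...     | yes k<m = subst (_≤ r) (sym (Shape.middle s k k<m)) (m⊓n≤m r _)
  ...     | no k≮m with m≤n⇒∃[o]m+o≡n (≮⇒≥ k≮m)
  ...       | i , refl = subst (_≤ r) (sym (trans (cong (row lam) (sym (+-assoc d m i))) (Shape.overflow s i)))
                           (m≤n+o⇒m∸n≤o (N i + d) r (+-mono-≤ (≤r i) d≤r))

  r⊓a<r⇒a<r : ∀ a → r ⊓ a < r → a < r
  r⊓a<r⇒a<r a lt with r ≤? a
  ... | yes r≤a = ⊥-elim (<-irrefl (m≤n⇒m⊓n≡m r≤a) lt)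
  ... | no r≰a  = ≰⇒> r≰a

  module AddHook (d : ℕ) (d<D : suc d ≤ D) (μ lam : List ℕ) (sμ : Shape d μ) (Pμ : IsPartition μ)
                 (H : AddRimHook n r μ lam) where
    open RimHook m r n n≡m+r μ lam Pμ H
    open Shape sμ

    d≤r : d ≤ r
    d≤r = ≤-trans (n≤1+n d) (≤-trans d<D D≤r)

    -- the first d rows of μ are full, so the head lies in row ≥ d
    d≤hd : d ≤ hd
    d≤hd with hd <? d
    ... | yes hd<d = ⊥-elim (<-irrefl (full hd hd<d) head-fits)
    ... | no hd≮d  = ≮⇒≥ hd≮d

    -- h: the row of ν (counted within R_r) in which the head lies
    h : ℕ
    h = proj₁ (m≤n⇒∃[o]m+o≡n d≤hd)
    d+h≡hd : d + h ≡ hd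
    d+h≡hd = proj₂ (m≤n⇒∃[o]m+o≡n d≤hd)

    -- row m − D of ν still fits after adding d + 1, so h ≤ m − D < m
    h<m : h < m
    h<m = ≤-<-trans h≤p p<m
      where
      p : ℕ
      p = m ∸ D
      p<m : p < m
      p<m = subst (suc p ≤_) (m+[n∸m]≡n D≤m) (+-monoˡ-≤ p (≤-trans (s≤s z≤n) d<D))
      Np+d<r : N p + d < r
      Np+d<r = ≤-trans (≤-reflexive (sym (+-suc (N p) d)))
        (≤-trans (+-monoʳ-≤ (N p) d<D) (top-rows p (≤-reflexive (sym (m+[n∸m]≡n D≤m)))))
      h≤p : h ≤ p
      h≤p with p <? h
      ... | no p≮h = ≮⇒≥ p≮h
      ... | yes p<h = ⊥-elim (<-irrefl refl (<-≤-trans Mp<r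
              (full-below-head (d + p) (subst (d + p <_) d+h≡hd (+-monoʳ-< d p<h)))))
        where
        Mp<r : M (d + p) < r
        Mp<r = subst (_< r) (sym (middle p p<m)) (≤-<-trans (m⊓n≤n r _) Np+d<r)

    Nh+d<r : N h + d < r
    Nh+d<r = r⊓a<r⇒a<r (N h + d) (subst (_< r) (trans (cong M (sym d+h≡hd)) (middle h h<m)) head-fits)

    Ni+d≥r : ∀ i → i < h → r ≤ N i + d
    Ni+d≥r i i<h = ≤-trans (subst (r ≤_) (middle i (<-trans i<h h<m))
                     (full-below-head (d + i) (subst (d + i <_) d+h≡hd (+-monoʳ-< d i<h)))) (m⊓n≤n r _)

    Ni+d<r : ∀ i → h ≤ i → N i + d < r
    Ni+d<r i h≤i = ≤-<-trans (+-monoˡ-≤ d (rows-antitone ν P h≤i)) Nh+d<r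

    μ-ends : M (hd + m) ≡ 0
    μ-ends = trans (cong M (trans (cong (_+ m) (sym d+h≡hd)) (xy∙z≈xz∙y d h m)))
               (trans (overflow h) (m≤n⇒m∸n≡0 (<⇒≤ Nh+d<r)))

    full-to-head : ∀ j → j ≤ hd → L j ≡ r
    full-to-head j j≤hd with m≤n⇒m<n∨m≡n j≤hd
    ... | inj₁ j<hd = trans (rows-below-head j j<hd)
                        (≤-antisym (shape-≤r d μ d≤r sμ j) (full-below-head j j<hd))
    ... | inj₂ refl = head-row

    full′ : ∀ j → j < suc d → L j ≡ r
    full′ j j<d+1 = full-to-head j (≤-trans (≤-pred j<d+1) d≤hd)

    middle′ : ∀ i → i < m → L (suc d + i) ≡ r ⊓ (N i + suc d)
    middle′ i i<m with i <? h
    ... | yes i<h = trans (full-to-head (suc (d + i)) (subst (suc (d + i) ≤_) d+h≡hd (+-monoʳ-< d i<h)))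
                      (sym (m≤n⇒m⊓n≡m (≤-trans (Ni+d≥r i i<h) (+-monoʳ-≤ (N i) (n≤1+n d)))))
    ... | no i≮h with m≤n⇒∃[o]m+o≡n (≮⇒≥ i≮h)
    ...   | k , refl = begin
        L (suc (d + (h + k)))
      ≡⟨ cong (λ x → L (suc x)) (trans (sym (+-assoc d h k)) (cong (_+ k) d+h≡hd)) ⟩
        L (suc (hd + k))
      ≡⟨ hook-rows μ-ends k (≤-<-trans (m≤n+m k h) i<m) ⟩
        suc (M (hd + k))
      ≡⟨ cong (λ x → suc (M x)) (trans (cong (_+ k) (sym d+h≡hd)) (+-assoc d h k)) ⟩
        suc (M (d + (h + k)))
      ≡⟨ cong suc (trans (middle (h + k) i<m) (m≥n⇒m⊓n≡n (<⇒≤ fits))) ⟩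
        suc (N (h + k) + d)
      ≡⟨ sym (+-suc (N (h + k)) d) ⟩
        N (h + k) + suc d
      ≡⟨ sym (m≥n⇒m⊓n≡n (subst (_≤ r) (sym (+-suc (N (h + k)) d)) fits)) ⟩
        r ⊓ (N (h + k) + suc d)
      ∎
      where
      open ≡-Reasoning
      fits : N (h + k) + d < r
      fits = Ni+d<r (h + k) (m≤m+n h k)

    overflow′ : ∀ i → L (suc d + m + i) ≡ (N i + suc d) ∸ r
    overflow′ i with i <? h
    ... | yes i<h = begin
        L (suc d + m + i)
      ≡⟨ cong (L ∘ suc) idx ⟩
        L (suc (hd + (w + i)))
      ≡⟨ hook-rows μ-ends (w + i) (subst (w + i <_) (trans (+-comm w h) h+w≡m) (+-monoʳ-< w i<h)) ⟩
        suc (M (hd + (w + i)))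
      ≡⟨ cong (suc ∘ M) (sym idx) ⟩
        suc (M (d + m + i))
      ≡⟨ cong suc (overflow i) ⟩
        suc ((N i + d) ∸ r)
      ≡⟨ sym (+-∸-assoc 1 (Ni+d≥r i i<h)) ⟩
        suc (N i + d) ∸ r
      ≡⟨ cong (_∸ r) (sym (+-suc (N i) d)) ⟩
        (N i + suc d) ∸ r
      ∎
      where
      open ≡-Reasoning
      w : ℕ
      w = proj₁ (m≤n⇒∃[o]m+o≡n (<⇒≤ h<m))
      h+w≡m : h + w ≡ m
      h+w≡m = proj₂ (m≤n⇒∃[o]m+o≡n (<⇒≤ h<m))
      regroup : ∀ a b c e → a + (b + c) + e ≡ (a + b) + (c + e)
      regroup = solve-∀
      idx : d + m + i ≡ hd + (w + i)
      idx = trans (cong (λ x → d + x + i) (sym h+w≡m)) (trans (regroup d h w i) (cong (_+ (w + i)) d+h≡hd))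
    ... | no i≮h with m≤n⇒∃[o]m+o≡n (≮⇒≥ i≮h)
    ...   | k , refl = begin
        L (suc d + m + (h + k))
      ≡⟨ cong (L ∘ suc) idx ⟩
        L (suc (hd + m + k))
      ≡⟨ rows-above-hook μ-ends k ⟩
        M (suc (hd + m + k))
      ≡⟨ cong M idx′ ⟩
        M (d + m + suc (h + k))
      ≡⟨ overflow (suc (h + k)) ⟩
        (N (suc (h + k)) + d) ∸ r
      ≡⟨ m≤n⇒m∸n≡0 (<⇒≤ (Ni+d<r (suc (h + k)) (≤-trans (m≤m+n h k) (n≤1+n _)))) ⟩
        0
      ≡⟨ sym (m≤n⇒m∸n≡0 (subst (_≤ r) (sym (+-suc (N (h + k)) d)) (Ni+d<r (h + k) (m≤m+n h k)))) ⟩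
        (N (h + k) + suc d) ∸ r
      ∎
      where
      open ≡-Reasoning
      regroup : ∀ a b c e → a + c + (b + e) ≡ (a + b) + c + e
      regroup = solve-∀
      idx : d + m + (h + k) ≡ hd + m + k
      idx = trans (regroup d h m k) (cong (λ x → x + m + k) d+h≡hd)
      regroup′ : ∀ a b c e → suc (a + b + c + e) ≡ a + c + suc (b + e)
      regroup′ = solve-∀
      idx′ : suc (hd + m + k) ≡ d + m + suc (h + k)
      idx′ = trans (cong (λ x → suc (x + m + k)) (sym d+h≡hd)) (regroup′ d h m k)

    shape-suc : Shape (suc d) lam
    shape-suc = record { full = full′ ; middle = middle′ ; overflow = overflow′ }

  shape : ∀ d lam → AddRimHooks n r ν d lam → d ≤ D → Shape d lam × IsPartition lam
  shape .0 .ν none _ = shape-zero , P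
  shape (suc d) lam (more {μ = μ} rest H) d<D with shape d μ rest (≤-trans (n≤1+n d) d<D)
  ... | sμ , Pμ = AddHook.shape-suc d d<D μ lam sμ Pμ H , proj₁ H

-- Arithmetic of two rows x (of ρ) and y (of ν) related as in
-- rotation-high, x + r = y + t + d, against the threshold t ≤ r.
module RelatedRows (x r y t d : ℕ) (x+r≡y+t+d : x + r ≡ y + (t + d)) where

  private
    x+r≡t+[y+d] : x + r ≡ t + (y + d)
    x+r≡t+[y+d] = trans x+r≡y+t+d (x∙yz≈y∙xz y t d)

  t≤x⇒r≤y+d : t ≤ x → r ≤ y + d
  t≤x⇒r≤y+d t≤x = +-cancelˡ-≤ t r (y + d) (≤-trans (+-monoˡ-≤ r t≤x) (≤-reflexive x+r≡t+[y+d]))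

  t≤x⇒overflow : t ≤ x → (y + d) ∸ r ≡ x ∸ t
  t≤x⇒overflow t≤x with m≤n⇒∃[o]m+o≡n t≤x
  ... | z , refl = trans (cong (_∸ r) (sym z+r≡y+d)) (trans (m+n∸n≡m z r) (sym (m+n∸m≡n t z)))
    where
    z+r≡y+d : z + r ≡ y + d
    z+r≡y+d = +-cancelˡ-≡ t (z + r) (y + d) (trans (sym (+-assoc t z r)) x+r≡t+[y+d])

  x<t⇒y+d<r : x < t → y + d < r
  x<t⇒y+d<r x<t = +-cancelˡ-< t (y + d) r (subst (_< t + r) x+r≡t+[y+d] (+-monoˡ-< r x<t))

  x<t⇒middle : x < t → t ≤ r → r ⊓ (y + d) ≡ x + (r ∸ t)
  x<t⇒middle x<t t≤r = trans (m≥n⇒m⊓n≡n (<⇒≤ (x<t⇒y+d<r x<t)))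
    (+-cancelˡ-≡ t _ _ (trans (sym x+r≡t+[y+d])
      (trans (cong (x +_) (sym (m+[n∸m]≡n t≤r))) (x∙yz≈y∙xz x t (r ∸ t)))))

module Proposition (m r n : ℕ) (m+r≡n : m + r ≡ n) (ν : List ℕ) (box : InBox m r ν)
                   (ρ : List ℕ) (boxρ : InBox m r ρ) (b-rot : bits m r ρ ≡ rotate r (bits m r ν))
                   (d : ℕ) (d≤D : d ≤ diag₀ (complement m r ν))
                   (λ' : List ℕ) (hooks : AddRimHooks n r ν d λ') where

  open Rotation m r ν box ρ boxρ b-rot
  open SumShape m r n (sym m+r≡n) ν box using (N; Shape; shape)

  private
    shapeλ : Shape d λ' × IsPartition λ'
    shapeλ = shape d λ' hooks d≤D
    open Shape (proj₁ shapeλ)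
    Pλ : IsPartition λ'
    Pλ = proj₂ shapeλ
    Pρ : IsPartition ρ
    Pρ = proj₁ boxρ

  Λ : ℕ → ℕ
  Λ = row λ'

  t : ℕ
  t = diag₀ (complement m r λ')

  open ComplementDiagonal m r λ' Pλ renaming (diag-≤ to t≤m; diag-sound to below-t⇒; diag-complete to below-t⇐)

  k<t⇒k+d<D : ∀ k → k < m → k < t → k + d < D
  k<t⇒k+d<D k k<m k<t with split< k<m
  ... | j , e with j <? d
  ...   | yes j<d = ⊥-elim (n≮0 (≤-trans (below-t⇒ k j e k<t)
                     (≤-reflexive (trans (cong (r ∸_) (full j j<d)) (n∸n≡0 r)))))
  ...   | no j≮d with m≤n⇒∃[o]m+o≡n (≮⇒≥ j≮d)
  ...     | i , refl = below-diagonal⇐ (k + d) i e′ (subst (_≤ r) (cong suc (x∙yz≈xz∙y k (N i) d)) fits)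
    where
    e′ : suc ((k + d) + i) ≡ m
    e′ = trans (cong suc (+-assoc k d i)) e
    i<m : i < m
    i<m = subst (i <_) e (s≤s (≤-trans (m≤n+m i d) (m≤n+m (d + i) k)))
    fits⊓ : suc k + (r ⊓ (N i + d)) ≤ r
    fits⊓ = m≤o∸n⇒m+n≤o (suc k) (m⊓n≤m r _) (subst (λ x → suc k ≤ r ∸ x) (middle i i<m) (below-t⇒ k (d + i) e k<t))
    ⊓≡ : r ⊓ (N i + d) ≡ N i + d
    ⊓≡ with r ≤? N i + d
    ... | yes r≤ = ⊥-elim (<-irrefl (m≤n⇒m⊓n≡m r≤) (≤-trans (s≤s (m≤n+m _ k)) fits⊓))
    ... | no r≰  = m≥n⇒m⊓n≡n (<⇒≤ (≰⇒> r≰))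
    fits : suc k + (N i + d) ≤ r
    fits = subst (λ x → suc k + x ≤ r) ⊓≡ fits⊓

  k+d<D⇒k<t : ∀ k → k < m → k + d < D → k < t
  k+d<D⇒k<t k k<m k+d<D with split< k<m
  ... | j , e with j <? d
  ...   | yes j<d = ⊥-elim (<-irrefl refl (<-≤-trans j<d
                     (+-cancelˡ-≤ k d j (≤-pred (≤-trans k+d<D (≤-trans D≤m (≤-reflexive (sym e))))))))
  ...   | no j≮d with m≤n⇒∃[o]m+o≡n (≮⇒≥ j≮d)
  ...     | i , refl = below-t⇐ k (d + i) e
                         (subst (λ x → suc k ≤ r ∸ x) (sym (trans (middle i i<m) ⊓≡)) (m+n≤o⇒m≤o∸n (suc k) fits))
    where
    i<m : i < m
    i<m = subst (i <_) e (s≤s (≤-trans (m≤n+m i d) (m≤n+m (d + i) k)))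
    fits : suc k + (N i + d) ≤ r
    fits = subst (_≤ r) (cong suc (xy∙z≈x∙zy k d (N i)))
             (below-diagonal⇒ (k + d) i (trans (cong suc (+-assoc k d i)) e) k+d<D)
    ⊓≡ : r ⊓ (N i + d) ≡ N i + d
    ⊓≡ = m≥n⇒m⊓n≡n (≤-trans (m≤n+m _ (suc k)) fits)

  t+d≡D : t + d ≡ D
  t+d≡D = trans (cong (_+ d) t≡D∸d) (m∸n+n≡m d≤D)
    where
    t≡D∸d : t ≡ D ∸ d
    t≡D∸d = threshold-unique m t (D ∸ d) t≤m (≤-trans (m∸n≤m D d) D≤m)
      (λ k k<m k<t → m+n≤o⇒m≤o∸n (suc k) (k<t⇒k+d<D k k<m k<t))
      (λ k k<m k<D∸d → k+d<D⇒k<t k k<m (m≤o∸n⇒m+n≤o (suc k) d≤D k<D∸d))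

  t≤D : t ≤ D
  t≤D = subst (t ≤_) t+d≡D (m≤m+n t d)

  t≤r : t ≤ r
  t≤r = ≤-trans t≤D D≤r

  -- a = ρ'_t.  The first D rows of ρ have length ≥ D ≥ t, so t ≤ a.
  open Conjugate m t ρ Pρ

  a : ℕ
  a = conj m ρ t

  t≤ρ-low : ∀ j → j < D → t ≤ row ρ j
  t≤ρ-low j j<D = ≤-trans t≤D (subst (D ≤_) (sym (rotation-low j j<D)) (m≤m+n D _))

  low-rows<a : ∀ j → j < D → j < a
  low-rows<a j j<D = conj-complete j (<-≤-trans j<D D≤m) (t≤ρ-low j j<D)

  t≤a : t ≤ a
  t≤a with a <? t
  ... | no a≮t  = ≮⇒≥ a≮t
  ... | yes a<t = ⊥-elim (<-irrefl refl (low-rows<a a (<-≤-trans a<t t≤D)))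

  ρ<t : ∀ j → j < m → ¬ j < a → row ρ j < t
  ρ<t j j<m j≮a with t ≤? row ρ j
  ... | no t≰  = ≰⇒> t≰
  ... | yes t≤ = ⊥-elim (j≮a (conj-complete j j<m t≤))

  ρ-high : ∀ j → D + j < m → row ρ (D + j) + r ≡ N j + (t + d)
  ρ-high j D+j<m = trans (rotation-high j D+j<m) (cong (N j +_) (sym t+d≡D))

  -- m = t + (a − t) + (m − a) = t + d + (m − D)
  private
    u : ℕ
    u = a ∸ t
    v : ℕ
    v = m ∸ a
    w : ℕ
    w = m ∸ D

    t+u≡a : t + u ≡ a
    t+u≡a = m+[n∸m]≡n t≤a

    t+[u+v]≡m : t + (u + v) ≡ m
    t+[u+v]≡m = trans (sym (+-assoc t u v)) (trans (cong (_+ v) t+u≡a) (m+[n∸m]≡n conj-≤))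

    m∸t≡u+v : m ∸ t ≡ u + v
    m∸t≡u+v = trans (cong (_∸ t) (sym t+[u+v]≡m)) (m+n∸m≡n t (u + v))

    m∸t≡d+w : m ∸ t ≡ d + w
    m∸t≡d+w = trans (cong (_∸ t) (sym t+[d+w]≡m)) (m+n∸m≡n t (d + w))
      where
      t+[d+w]≡m : t + (d + w) ≡ m
      t+[d+w]≡m = trans (sym (+-assoc t d w)) (trans (cong (_+ w) t+d≡D) (m+[n∸m]≡n D≤m))

    length-ρL : length (ρL m t ρ) ≡ u + v
    length-ρL = trans (length-++ (replicate u t))
      (cong₂ _+_ (length-replicate u) (trans (length-drop a (rows m ρ)) (cong (_∸ a) (length-rows m ρ))))

    ρL-low : ∀ i → i < u → row (ρL m t ρ) i ≡ t
    ρL-low i i<u = trans (row-++ˡ (replicate u t) _ i (subst (i <_) (sym (length-replicate u)) i<u))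
                         (row-replicate u t i i<u)

    ρL-high : ∀ i → a + i < m → row (ρL m t ρ) (u + i) ≡ row ρ (a + i)
    ρL-high i a+i<m = trans (cong (λ x → row (ρL m t ρ) (x + i)) (sym (length-replicate u)))
      (trans (row-++ʳ (replicate u t) (drop a (rows m ρ)) i)
      (trans (row-drop a (rows m ρ) i) (row-rows< m ρ (a + i) a+i<m)))

    ρ↾a : ℕ → ℕ
    ρ↾a = row (take a (rows m ρ))

    ρ↾a-low : ∀ i → i < a → ρ↾a i ≡ row ρ i
    ρ↾a-low i i<a = trans (row-take< a (rows m ρ) i i<a) (row-rows< m ρ i (<-≤-trans i<a conj-≤))

    ρ↾a-high : ∀ i → a ≤ i → ρ↾a i ∸ t ≡ 0
    ρ↾a-high i a≤i = trans (cong (_∸ t) (row-take≥ a (rows m ρ) i a≤i)) (0∸n≡0 t)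

  -- Row i < m − t of λ: the first d rows are r = t + (r − t); a middle row
  -- d + i′ faces row j = t + d + i′ = D + i′ of ρ, which is ≥ t iff j < a.
  η¹-row : ∀ i → i < u + v → Λ i ≡ row (ρL m t ρ) i + (r ∸ t)
  η¹-row i i<u+v with i <? d
  ... | yes i<d = trans (full i i<d) (sym (trans (cong (_+ (r ∸ t)) (ρL-low i i<u)) (m+[n∸m]≡n t≤r)))
    where
    i<u : i < u
    i<u = +-cancelˡ-< t i u (subst (t + i <_) (sym t+u≡a)
            (low-rows<a (t + i) (subst (t + i <_) t+d≡D (+-monoʳ-< t i<d))))
  ... | no i≮d with m≤n⇒∃[o]m+o≡n (≮⇒≥ i≮d)
  ...   | i′ , refl = trans (middle i′ i′<m) middle-row
    where
    j : ℕ
    j = t + (d + i′)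
    j≡D+i′ : j ≡ D + i′
    j≡D+i′ = trans (sym (+-assoc t d i′)) (cong (_+ i′) t+d≡D)
    j<m : j < m
    j<m = subst (j <_) t+[u+v]≡m (+-monoʳ-< t i<u+v)
    i′<m : i′ < m
    i′<m = ≤-<-trans (≤-trans (m≤n+m i′ d) (m≤n+m (d + i′) t)) j<m
    open RelatedRows (row ρ j) r (N i′) t d
      (trans (cong (λ x → row ρ x + r) j≡D+i′) (ρ-high i′ (subst (_< m) j≡D+i′ j<m)))
    middle-row : r ⊓ (N i′ + d) ≡ row (ρL m t ρ) (d + i′) + (r ∸ t)
    middle-row with (d + i′) <? u
    ... | yes <u = trans (m≤n⇒m⊓n≡m (t≤x⇒r≤y+d (conj-sound j (subst (j <_) t+u≡a (+-monoʳ-< t <u)))))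
                     (sym (trans (cong (_+ (r ∸ t)) (ρL-low (d + i′) <u)) (m+[n∸m]≡n t≤r)))
    ... | no ≮u with m≤n⇒∃[o]m+o≡n (≮⇒≥ ≮u)
    ...   | i₂ , u+i₂≡ = trans (x<t⇒middle ρj<t t≤r) (cong (_+ (r ∸ t)) (sym ρL≡ρj))
      where
      a+i₂≡j : a + i₂ ≡ j
      a+i₂≡j = trans (cong (_+ i₂) (sym t+u≡a)) (trans (+-assoc t u i₂) (cong (t +_) u+i₂≡))
      ρj<t : row ρ j < t
      ρj<t = ρ<t j j<m (λ j<a → <-irrefl refl (≤-<-trans (m≤m+n a i₂) (subst (_< a) (sym a+i₂≡j) j<a)))
      ρL≡ρj : row (ρL m t ρ) (d + i′) ≡ row ρ j
      ρL≡ρj = trans (cong (row (ρL m t ρ)) (sym u+i₂≡))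
                (trans (ρL-high i₂ (subst (_< m) (sym a+i₂≡j) j<m)) (cong (row ρ) a+i₂≡j))

  η¹-rows : η¹ m t λ' ≈ₚ (ρL m t ρ +ₚ replicate (m ∸ t) (r ∸ t))
  η¹-rows i with i <? m ∸ t
  ... | yes i<m∸t = trans (row-rows< (m ∸ t) λ' i i<m∸t) (trans (η¹-row i i<u+v)
          (sym (trans (row-zipWith< (ρL m t ρ) (replicate (m ∸ t) (r ∸ t)) i
                        (subst (i <_) (sym length-ρL) i<u+v)
                        (subst (i <_) (sym (length-replicate (m ∸ t))) i<m∸t))
                 (cong (row (ρL m t ρ) i +_) (row-replicate (m ∸ t) (r ∸ t) i i<m∸t)))))
    where
    i<u+v : i < u + v
    i<u+v = subst (i <_) m∸t≡u+v i<m∸t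
  ... | no i≮m∸t = trans (row-rows≥ (m ∸ t) λ' i (≮⇒≥ i≮m∸t))
          (sym (row-zipWith≥ (ρL m t ρ) (replicate (m ∸ t) (r ∸ t)) i
                 (subst (_≤ i) (sym (length-replicate (m ∸ t))) (≮⇒≥ i≮m∸t))))

  -- Row m − t + i of λ.  For i < D it is the middle row d + w + i, equal
  -- to ν_{w+i+1} + d = ρ_{i+1} − t; beyond it is the overflow row d + m + i′
  -- facing row D + i′ of ρ.
  η²-row : ∀ i → Λ ((d + w) + i) ≡ ρ↾a i ∸ t
  η²-row i with i <? D
  ... | yes i<D = begin
      Λ ((d + w) + i)
    ≡⟨ cong Λ (+-assoc d w i) ⟩
      Λ (d + (w + i))
    ≡⟨ middle (w + i) w+i<m ⟩
      r ⊓ (N (w + i) + d)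
    ≡⟨ m≥n⇒m⊓n≡n (≤-trans (+-monoʳ-≤ (N (w + i)) d≤D)
                    (top-rows (w + i) (subst (_≤ D + (w + i)) (m+[n∸m]≡n D≤m) (+-monoʳ-≤ D (m≤m+n w i))))) ⟩
      N (w + i) + d
    ≡⟨ sym (trans (cong (_∸ t) (trans (cong (_+ N (w + i)) (sym t+d≡D)) (+-assoc t d _)))
              (trans (m+n∸m≡n t _) (+-comm d _))) ⟩
      (D + N (w + i)) ∸ t
    ≡⟨ cong (_∸ t) (sym (trans (ρ↾a-low i (low-rows<a i i<D)) (rotation-low i i<D))) ⟩
      ρ↾a i ∸ t
    ∎
    where
    open ≡-Reasoning
    w+i<m : w + i < m
    w+i<m = subst (w + i <_) (m∸n+n≡m D≤m) (+-monoʳ-< w i<D)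
  ... | no i≮D with m≤n⇒∃[o]m+o≡n (≮⇒≥ i≮D)
  ...   | i′ , refl = trans (cong Λ idx) (trans (overflow i′) overflow-row)
    where
    regroup : ∀ a b c e → (a + b) + (c + e) ≡ a + (b + c) + e
    regroup = solve-∀
    idx : (d + w) + (D + i′) ≡ d + m + i′
    idx = trans (regroup d w D i′) (cong (λ x → d + x + i′) (m∸n+n≡m D≤m))
    overflow-row : (N i′ + d) ∸ r ≡ ρ↾a (D + i′) ∸ t
    overflow-row with (D + i′) <? m
    ... | no ≮m = trans (m≤n⇒m∸n≡0 (≤-trans (+-monoʳ-≤ (N i′) d≤D) (top-rows i′ (≮⇒≥ ≮m))))
                    (sym (ρ↾a-high _ (≤-trans conj-≤ (≮⇒≥ ≮m))))
    ... | yes <m with (D + i′) <? a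
    ...   | yes <a = trans (t≤x⇒overflow (conj-sound _ <a)) (cong (_∸ t) (sym (ρ↾a-low _ <a)))
      where open RelatedRows (row ρ (D + i′)) r (N i′) t d (ρ-high i′ <m)
    ...   | no ≮a = trans (m≤n⇒m∸n≡0 (<⇒≤ (x<t⇒y+d<r (ρ<t _ <m ≮a)))) (sym (ρ↾a-high _ (≮⇒≥ ≮a)))
      where open RelatedRows (row ρ (D + i′)) r (N i′) t d (ρ-high i′ <m)

  η²-rows : η² m t λ' ≈ₚ ρR m t ρ
  η²-rows i = trans (row-drop (m ∸ t) λ' i) (trans (cong (λ x → Λ (x + i)) m∸t≡d+w)
                (trans (η²-row i) (sym (row-map (_∸ t) (take a (rows m ρ)) i (0∸n≡0 t)))))

proposition5p6 : (m r n : ℕ) → m + r ≡ n →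
    (ν : List ℕ) → InBox m r ν →
    (ρ : List ℕ) → InBox m r ρ → bits m r ρ ≡ rotate r (bits m r ν) →
    (d : ℕ) → d ≤ diag₀ (complement m r ν) →
    (λ' : List ℕ) → AddRimHooks n r ν d λ' →
    let t = diag₀ (complement m r λ') in
    (η¹ m t λ' ≈ₚ (ρL m t ρ +ₚ replicate (m ∸ t) (r ∸ t)))
      × (η² m t λ' ≈ₚ ρR m t ρ)
proposition5p6 m r n m+r≡n ν box ρ boxρ b-rot d d≤D λ' hooks = η¹-rows , η²-rows
  where open Proposition m r n m+r≡n ν box ρ boxρ b-rot d d≤D λ' hooks
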